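{- Let $P$ be a (possibly disjunctive) range-restricted logic program with negation. Every stable model $M$ of $P$ is contained in the minimum model of the standard version $st(P)$.
   Context: A rule has the form $A_1\vee\dots\vee A_m\leftarrow B_1,\dots,B_k,\neg C_1,\dots,\neg C_n$ ($m>0$, atoms built from constants, variables, function symbols); $body^+(r)=B_1,\dots,B_k$. A program is a finite set of rules; range-restricted: variables in the head or negative body occur in the positive body. Stable models (Gelfond–Lifschitz): for an interpretation $I$ (set of ground atoms), $P^I$ is obtained from the ground instantiation of $P$ by deleting rules having some $\neg A$ in the body with $A\in I$ and deleting the negative literals from the remaining rules; $I$ is a stable model iff $I$ is a minimal model of $P^I$. The standard version $st(P)$ replaces each rule $a_1\vee\dots\vee a_m\leftarrow body(r)$ by the $m$ rules $a_i\leftarrow body^+(r)$, $1\le i\le m$; it is a positive normal program with a unique minimum model. -}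

module Defs where

open import Data.Nat using (ℕ)
open import Data.Vec using (Vec; []; _∷_)
open import Data.List using (List; []; _∷_; concatMap; [_])
open import Data.List.NonEmpty using (List⁺; toList)
import Data.List.NonEmpty as L⁺
open import Data.List.Membership.Propositional using (_∈_)
open import Data.List.Relation.Unary.All using (All)
open import Data.List.Relation.Unary.Any using (Any)
open import Data.Product using (Σ; _×_; ∃; _,_)
open import Relation.Binary.PropositionalEquality using (_≡_)
open import Relation.Nullary using (¬_)
open import Relation.Unary using (Pred; _⊆_)
open import Level using (0ℓ)

-- A first-order signature: function symbols (constants are the 0-ary ones)
-- and predicate symbols, each with an arity.  Variables are natural numbers.
record Signature : Set₁ where
  field
    Fun    : Set
    funAr  : Fun → ℕ
    PredS  : Set
    predAr : PredS → ℕ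

Var : Set
Var = ℕ

module _ (Σs : Signature) where
  open Signature Σs

  data Term : Set where
    var : Var → Term
    fn  : (f : Fun) → Vec Term (funAr f) → Term

  data GTerm : Set where
    gfn : (f : Fun) → Vec GTerm (funAr f) → GTerm

  record Atom : Set where
    constructor atom
    field
      pred : PredS
      args : Vec Term (predAr pred)

  record GAtom : Set where
    constructor gatom
    field
      gpred : PredS
      gargs : Vec GTerm (predAr gpred)

  -- a rule  A₁ ∨ … ∨ Aₘ ← B₁,…,Bₖ, ¬C₁,…,¬Cₙ   with m > 0
  record Rule : Set where
    constructor rule
    field
      head : List⁺ Atom
      pos  : List Atom
      neg  : List Atom

  Program : Set
  Program = List Rule

  record GRule : Set where
    constructor grule
    field
      ghead : List GAtom
      gpos  : List GAtom
      gneg  : List GAtom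

  mutual
    data _occT_ (x : Var) : Term → Set where
      here : x occT var x
      inFn : ∀ {f ts} → x occTs ts → x occT fn f ts

    data _occTs_ (x : Var) : ∀ {n} → Vec Term n → Set where
      hd : ∀ {n t} {ts : Vec Term n} → x occT t → x occTs (t ∷ ts)
      tl : ∀ {n t} {ts : Vec Term n} → x occTs ts → x occTs (t ∷ ts)

  _occA_ : Var → Atom → Set
  x occA atom p ts = x occTs ts

  RangeRestricted : Rule → Set
  RangeRestricted r =
    (∀ x → Any (x occA_) (toList (Rule.head r)) → Any (x occA_) (Rule.pos r)) ×
    (∀ x → Any (x occA_) (Rule.neg r) → Any (x occA_) (Rule.pos r))

  RangeRestrictedProgram : Program → Set
  RangeRestrictedProgram P = ∀ r → r ∈ P → RangeRestricted r

  GSubst : Set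
  GSubst = Var → GTerm

  mutual
    substT : GSubst → Term → GTerm
    substT σ (var x)   = σ x
    substT σ (fn f ts) = gfn f (substTs σ ts)

    substTs : ∀ {n} → GSubst → Vec Term n → Vec GTerm n
    substTs σ []       = []
    substTs σ (t ∷ ts) = substT σ t ∷ substTs σ ts

  substA : GSubst → Atom → GAtom
  substA σ (atom p ts) = gatom p (substTs σ ts)

  substAs : GSubst → List Atom → List GAtom
  substAs σ = Data.List.map (substA σ)

  substR : GSubst → Rule → GRule
  substR σ (rule h p n) = grule (substAs σ (toList h)) (substAs σ p) (substAs σ n)

  Ground : Program → Pred GRule 0ℓ
  Ground P g = Σ Rule λ r → r ∈ P × Σ GSubst λ σ → g ≡ substR σ r

  Interp : Set₁
  Interp = Pred GAtom 0ℓ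

  IsModel : Pred GRule 0ℓ → Interp → Set
  IsModel Q I = ∀ g → Q g →
    All I (GRule.gpos g) → All (λ c → ¬ I c) (GRule.gneg g) → Any I (GRule.ghead g)

  Reduct : Program → Interp → Pred GRule 0ℓ
  Reduct P I g = Σ GRule λ g₀ → Ground P g₀ ×
    All (λ c → ¬ I c) (GRule.gneg g₀) ×
    g ≡ grule (GRule.ghead g₀) (GRule.gpos g₀) []

  IsMinimalModel : Pred GRule 0ℓ → Interp → Set₁
  IsMinimalModel Q M = IsModel Q M × (∀ N → IsModel Q N → N ⊆ M → M ⊆ N)

  IsStableModel : Program → Interp → Set₁
  IsStableModel P M = IsMinimalModel (Reduct P M) M

  -- standard version st(P): each A₁ ∨ … ∨ Aₘ ← body(r) becomes Aᵢ ← body⁺(r)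
  st : Program → Program
  st = concatMap (λ r → Data.List.map (λ a → rule (a L⁺.∷ []) (Rule.pos r) [])
                                         (toList (Rule.head r)))

  IsMinimumModel : Program → Interp → Set₁
  IsMinimumModel P M = IsModel (Ground P) M × (∀ N → IsModel (Ground P) N → M ⊆ N)

module Submission where

-- Idea: the intersection M ∩ M₀ is again a model of the reduct P^M.  Indeed,
-- take a ground instance  h ← b⁺  of P^M whose body holds in M ∩ M₀.  Since M
-- models P^M, some head atom of h lies in M; since M₀ models st(P) and b⁺ holds
-- in M₀, *every* head atom of h lies in M₀ (each one is the head of a rule
-- of st(P) with the same positive body).  Hence some head atom lies in M ∩ M₀.
-- Minimality of M then forces M ⊆ M ∩ M₀ ⊆ M₀.

open import Defs
open import Relation.Unary using (Pred; _⊆_; _∩_)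
open import Data.List using (List; []; _∷_)
open import Data.List.NonEmpty using (toList)
import Data.List.NonEmpty as L⁺
open import Data.List.Membership.Propositional using (_∈_)
open import Data.List.Membership.Propositional.Properties using (∈-map⁺; ∈-concat⁺′)
open import Data.List.Relation.Unary.All as All using (All; []; _∷_)
open import Data.List.Relation.Unary.All.Properties using (map⁺)
open import Data.List.Relation.Unary.Any using (Any; here; there)
open import Data.List.Relation.Unary.Any.Properties using (singleton⁻)
open import Data.Product using (_,_; proj₁; proj₂)
open import Relation.Binary.PropositionalEquality using (refl)
open import Level using (0ℓ)

Any-∩ : ∀ {a p q} {A : Set a} {P : Pred A p} {Q : Pred A q} {xs : List A} →
        All Q xs → Any P xs → Any (P ∩ Q) xs
Any-∩ (qx ∷ _)  (here px)  = here (px , qx)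
Any-∩ (_ ∷ qxs) (there pxs) = there (Any-∩ qxs pxs)

module _ (Σs : Signature) where

  -- A minimal model M of Q lies inside every N for which M ∩ N is still a
  -- model of Q: the intersection is a submodel of M, hence equal to it.
  minimal⊆ : (Q : Pred (GRule Σs) 0ℓ) (M N : Interp Σs) →
             IsMinimalModel Σs Q M → IsModel Σs Q (M ∩ N) → M ⊆ N
  minimal⊆ Q M N (_ , minimal) M∩N-model m =
    proj₂ (minimal (M ∩ N) M∩N-model proj₁ m)

  ∈-st : (P : Program Σs) {r : Rule Σs} {a : Atom Σs} →
         r ∈ P → a ∈ toList (Rule.head r) →
         rule (a L⁺.∷ []) (Rule.pos r) [] ∈ st Σs P
  ∈-st P r∈P a∈head = ∈-concat⁺′ (∈-map⁺ _ a∈head) (∈-map⁺ _ r∈P)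

  st-model-heads : (P : Program Σs) (N : Interp Σs) → IsModel Σs (Ground Σs (st Σs P)) N →
                   {r : Rule Σs} → r ∈ P → (σ : GSubst Σs) →
                   All N (substAs Σs σ (Rule.pos r)) →
                   All N (substAs Σs σ (toList (Rule.head r)))
  st-model-heads P N N-model {r} r∈P σ body =
    map⁺ (All.tabulate head-holds)
    where
    head-holds : ∀ {a} → a ∈ toList (Rule.head r) → N (substA Σs σ a)
    head-holds {a} a∈head = singleton⁻
      (N-model _ (rule (a L⁺.∷ []) (Rule.pos r) [] , ∈-st P r∈P a∈head , σ , refl)
               body [])

  ∩-models-reduct : (P : Program Σs) (M M₀ : Interp Σs) →
                    IsModel Σs (Reduct Σs P M) M →
                    IsModel Σs (Ground Σs (st Σs P)) M₀ →
                    IsModel Σs (Reduct Σs P M) (M ∩ M₀)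
  ∩-models-reduct P M M₀ M-model M₀-model
    _ (_ , (rule h p n , r∈P , σ , refl) , neg-ok , refl) body _ =
    Any-∩ (st-model-heads P M₀ M₀-model r∈P σ (All.map proj₂ body))
          (M-model _ (_ , (rule h p n , r∈P , σ , refl) , neg-ok , refl)
                   (All.map proj₁ body) [])

lemma2 : (Σs : Signature) (P : Program Σs) → RangeRestrictedProgram Σs P →
    (M M₀ : Interp Σs) → IsStableModel Σs P M → IsMinimumModel Σs (st Σs P) M₀ →
    M ⊆ M₀
lemma2 Σs P _ M M₀ M-stable (M₀-model , _) =
  minimal⊆ Σs (Reduct Σs P M) M M₀ M-stable
    (∩-models-reduct Σs P M M₀ (proj₁ M-stable) M₀-model)
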